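{- For every integer $n\ge1$, the map $\Phi$ restricts to a bijection from $\mathcal{M}^\star_n$ onto $\mathcal{GD}^\star_n$, and to a bijection from $\mathcal{M}^{s,\star}_n$ onto $\mathcal{D}^\star_n$.
   Context: For $n\ge1$, an $n$-multiset of $[n]=\{1,\dots,n\}$ is written as the unique non-decreasing sequence $\pi=\pi_1\cdots\pi_n$ of its elements; $\mathcal{M}_n$ is the set of these. $\pi$ is superdiagonal if $i\le\pi_i$ for all $i$. $\mathcal{M}^\star_n$ is the set of $\pi\in\mathcal{M}_n$ with no consecutive integers, i.e. $\pi_{i+1}\ne\pi_i+1$ for all $i\in[n-1]$, and $\mathcal{M}^{s,\star}_n$ is the set of superdiagonal elements of $\mathcal{M}^\star_n$. Lattice paths are words in $U$ (step $(1,1)$) and $D$ (step $(1,-1)$) starting at $(0,0)$. $\mathcal{GD}_n$ is the set of words with $n$ letters $U$ and $n$ letters $D$ beginning with $U$ (Grand-Dyck paths of semilength $n$ starting with an up step), and $\mathcal{D}_n\subseteq\mathcal{GD}_n$ the Dyck paths (never going below the $x$-axis). For a set of paths $\mathcal{P}$, $\mathcal{P}^\star$ denotes the subset of paths that contain no occurrence of the factor $DUD$ (three consecutive letters). The map $\Phi$ sends $\pi$ to $U^{\pi_1}DU^{\pi_2-\pi_1}D\cdots U^{\pi_n-\pi_{n-1}}DU^{n-\pi_n}$. -}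

module Defs where

open import Data.Nat using (ℕ; zero; suc; _≤_; _∸_)
open import Data.Fin using (Fin; toℕ)
open import Data.List using (List; []; _∷_; _++_; length; replicate; take; lookup)
open import Data.List.Relation.Unary.All using (All)
open import Data.List.Relation.Unary.Linked using (Linked)
open import Data.Product using (_×_; Σ; ∃; ∃₂)
open import Relation.Binary.PropositionalEquality using (_≡_; _≢_)
open import Relation.Nullary using (¬_)

IsMultiset : ℕ → List ℕ → Set
IsMultiset n π =
  (length π ≡ n) × All (λ x → (1 ≤ x) × (x ≤ n)) π × Linked _≤_ π

-- superdiagonal: i ≤ π_i (1-based), i.e. toℕ i + 1 ≤ lookup π i
Superdiagonal : List ℕ → Set
Superdiagonal π = (i : Fin (length π)) → suc (toℕ i) ≤ lookup π i

NoConsecutive : List ℕ → Set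
NoConsecutive π = Linked (λ a b → b ≢ suc a) π

InMstar : ℕ → List ℕ → Set
InMstar n π = IsMultiset n π × NoConsecutive π

InMsstar : ℕ → List ℕ → Set
InMsstar n π = InMstar n π × Superdiagonal π

data Step : Set where
  U D : Step

Path : Set
Path = List Step

countU : Path → ℕ
countU []      = 0
countU (U ∷ p) = suc (countU p)
countU (D ∷ p) = countU p

countD : Path → ℕ
countD []      = 0
countD (U ∷ p) = countD p
countD (D ∷ p) = suc (countD p)

IsGrandDyck : ℕ → Path → Set
IsGrandDyck n p = (countU p ≡ n) × (countD p ≡ n) × ∃ λ q → p ≡ U ∷ q

NonNegative : Path → Set
NonNegative p = (k : ℕ) → countD (take k p) ≤ countU (take k p)

IsDyck : ℕ → Path → Set
IsDyck n p = IsGrandDyck n p × NonNegative p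

HasDUD : Path → Set
HasDUD p = ∃₂ λ a b → p ≡ a ++ (D ∷ U ∷ D ∷ b)

InGDstar : ℕ → Path → Set
InGDstar n p = IsGrandDyck n p × ¬ HasDUD p

InDstar : ℕ → Path → Set
InDstar n p = IsDyck n p × ¬ HasDUD p

-- The map Φ : π ↦ U^{π₁} D U^{π₂-π₁} D ⋯ U^{πₙ-πₙ₋₁} D U^{n-πₙ}

Φ-go : ℕ → ℕ → List ℕ → Path
Φ-go n prev []       = replicate (n ∸ prev) U
Φ-go n prev (x ∷ xs) = replicate (x ∸ prev) U ++ (D ∷ Φ-go n x xs)

Φ : ℕ → List ℕ → Path
Φ n π = Φ-go n 0 π

RestrictsToBijection : {X Y : Set} → (X → Y) → (X → Set) → (Y → Set) → Set
RestrictsToBijection {X} {Y} f A B =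
  ((x : X) → A x → B (f x))
  × ((x y : X) → A x → A y → f x ≡ f y → x ≡ y)
  × ((y : Y) → B y → Σ X λ x → A x × f x ≡ y)

-- Φ records π as the positions of the D steps: the i-th D is preceded by exactly π_i
-- letters U.  Reading these positions back off a path p gives an inverse Ψ on all
-- paths with n letters D and n letters U, and U-count bounds, sortedness and the
-- length of Ψ p come for free.  The three side conditions then match up: the path
-- starts with U iff π_1 ≥ 1; a factor DUD is a gap π_{i+1} - π_i = 1 between two
-- consecutive D's; and the height just after the i-th D is π_i - i, so the path
-- stays nonnegative iff π is superdiagonal.
module Submission where

open import Defs
open import Data.Nat using (ℕ; zero; suc; _≤_; _∸_; _+_; z≤n; s≤s)
open import Data.Nat.Properties
  using (≤-refl; ≤-trans; n≤1+n; m≤m+n; +-comm; +-suc; +-identityʳ;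
         m∸n+n≡m; m+n∸n≡m; +-∸-assoc)
open import Data.Fin using (Fin; toℕ) renaming (zero to fzero; suc to fsuc)
open import Data.List using (List; []; _∷_; _++_; length; replicate; take; lookup)
open import Data.List.Properties using (++-assoc; ++-identityʳ)
open import Data.List.Relation.Unary.All using (All; []; _∷_)
import Data.List.Relation.Unary.All as All
open import Data.List.Relation.Unary.Linked using (Linked; []; [-]; _∷_)
import Data.List.Relation.Unary.Linked as Linked
open import Data.Product using (∃; _×_; _,_; proj₁; proj₂)
open import Data.Sum using (_⊎_; inj₁; inj₂)
open import Function using (_∘_)
open import Relation.Binary.PropositionalEquality
open import Relation.Nullary using (¬_)

Sorted : List ℕ → Set
Sorted = Linked _≤_

Us : ℕ → Path
Us k = replicate k U

Sorted-0∷ : ∀ {xs} → Sorted xs → Sorted (0 ∷ xs)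
Sorted-0∷ []       = [-]
Sorted-0∷ [-]      = z≤n ∷ [-]
Sorted-0∷ (r ∷ rs) = z≤n ∷ r ∷ rs

Sorted-lowerHead : ∀ {c d ys} → c ≤ d → Sorted (d ∷ ys) → Sorted (c ∷ ys)
Sorted-lowerHead _   [-]          = [-]
Sorted-lowerHead c≤d (d≤y ∷ rest) = ≤-trans c≤d d≤y ∷ rest

m∸n+[o∸m]≡o∸n : ∀ {m n o} → n ≤ m → m ≤ o → m ∸ n + (o ∸ m) ≡ o ∸ n
m∸n+[o∸m]≡o∸n {m} {n} {o} n≤m m≤o = begin
  m ∸ n + (o ∸ m)      ≡⟨ +-comm (m ∸ n) (o ∸ m) ⟩
  o ∸ m + (m ∸ n)      ≡⟨ sym (+-∸-assoc (o ∸ m) n≤m) ⟩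
  (o ∸ m + m) ∸ n      ≡⟨ cong (_∸ n) (m∸n+n≡m m≤o) ⟩
  o ∸ n                ∎
  where open ≡-Reasoning

HasDUD-++ˡ : ∀ a {p} → HasDUD p → HasDUD (a ++ p)
HasDUD-++ˡ a (b , c , refl) = a ++ b , c , sym (++-assoc a b _)

¬HasDUD-[] : ¬ HasDUD []
¬HasDUD-[] ([]    , _ , ())
¬HasDUD-[] (_ ∷ _ , _ , ())

HasDUD-U∷⁻ : ∀ {p} → HasDUD (U ∷ p) → HasDUD p
HasDUD-U∷⁻ ([]     , _ , ())
HasDUD-U∷⁻ (D ∷ _  , _ , ())
HasDUD-U∷⁻ (U ∷ a  , b , refl) = a , b , refl

HasDUD-D∷⁻ : ∀ {p} → HasDUD (D ∷ p) → (∃ λ b → p ≡ U ∷ D ∷ b) ⊎ HasDUD p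
HasDUD-D∷⁻ ([]    , b , refl) = inj₁ (b , refl)
HasDUD-D∷⁻ (U ∷ _ , _ , ())
HasDUD-D∷⁻ (D ∷ a , b , refl) = inj₂ (a , b , refl)

HasDUD-Us++⁻ : ∀ k {p} → HasDUD (Us k ++ p) → HasDUD p
HasDUD-Us++⁻ zero    h = h
HasDUD-Us++⁻ (suc k) h = HasDUD-Us++⁻ k (HasDUD-U∷⁻ h)

¬HasDUD-Us : ∀ k → ¬ HasDUD (Us k)
¬HasDUD-Us zero    = ¬HasDUD-[]
¬HasDUD-Us (suc k) = ¬HasDUD-Us k ∘ HasDUD-U∷⁻

Us≢U∷D∷ : ∀ k {b} → Us k ≢ U ∷ D ∷ b
Us≢U∷D∷ (suc zero)    ()
Us≢U∷D∷ (suc (suc k)) ()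

Us++D∷≡U∷D∷⇒1 : ∀ k {r b} → Us k ++ D ∷ r ≡ U ∷ D ∷ b → k ≡ 1
Us++D∷≡U∷D∷⇒1 (suc zero)    _  = refl
Us++D∷≡U∷D∷⇒1 (suc (suc k)) ()

countU-++ : ∀ p q → countU (p ++ q) ≡ countU p + countU q
countU-++ []      q = refl
countU-++ (U ∷ p) q = cong suc (countU-++ p q)
countU-++ (D ∷ p) q = countU-++ p q

countD-++ : ∀ p q → countD (p ++ q) ≡ countD p + countD q
countD-++ []      q = refl
countD-++ (U ∷ p) q = countD-++ p q
countD-++ (D ∷ p) q = cong suc (countD-++ p q)

countU-Us : ∀ k → countU (Us k) ≡ k
countU-Us zero    = refl
countU-Us (suc k) = cong suc (countU-Us k)

countD-Us : ∀ k → countD (Us k) ≡ 0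
countD-Us zero    = refl
countD-Us (suc k) = countD-Us k

countU-Φ-go : ∀ n c xs → Sorted (c ∷ xs) → All (_≤ n) xs → countU (Φ-go n c xs) ≡ n ∸ c
countU-Φ-go n c []       _             _           = countU-Us (n ∸ c)
countU-Φ-go n c (x ∷ xs) (c≤x ∷ sorted) (x≤n ∷ bounded) = begin
  countU (Us (x ∸ c) ++ D ∷ Φ-go n x xs)          ≡⟨ countU-++ (Us (x ∸ c)) _ ⟩
  countU (Us (x ∸ c)) + countU (Φ-go n x xs)      ≡⟨ cong₂ _+_ (countU-Us (x ∸ c))
                                                           (countU-Φ-go n x xs sorted bounded) ⟩
  x ∸ c + (n ∸ x)                                 ≡⟨ m∸n+[o∸m]≡o∸n c≤x x≤n ⟩
  n ∸ c                                           ∎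
  where open ≡-Reasoning

countD-Φ-go : ∀ n c xs → countD (Φ-go n c xs) ≡ length xs
countD-Φ-go n c []       = countD-Us (n ∸ c)
countD-Φ-go n c (x ∷ xs) =
  trans (countD-++ (Us (x ∸ c)) _)
        (cong₂ _+_ (countD-Us (x ∸ c)) (cong suc (countD-Φ-go n x xs)))

-- Factors DUD of Φ π versus consecutive entries of π

¬HasDUD-D∷Φ-go : ∀ n x xs → Sorted (x ∷ xs) → NoConsecutive (x ∷ xs) →
                 ¬ HasDUD (D ∷ Φ-go n x xs)
¬HasDUD-D∷Φ-go n x xs sorted noCons h with HasDUD-D∷⁻ h
¬HasDUD-D∷Φ-go n x [] _ _ _ | inj₁ (_ , eq) = Us≢U∷D∷ (n ∸ x) eq
¬HasDUD-D∷Φ-go n x [] _ _ _ | inj₂ h′       = ¬HasDUD-Us (n ∸ x) h′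
¬HasDUD-D∷Φ-go n x (y ∷ ys) (x≤y ∷ _) (y≢1+x ∷ _) _ | inj₁ (_ , eq) =
  y≢1+x (trans (sym (m∸n+n≡m x≤y)) (cong (_+ x) (Us++D∷≡U∷D∷⇒1 (y ∸ x) eq)))
¬HasDUD-D∷Φ-go n x (y ∷ ys) (_ ∷ sorted) (_ ∷ noCons) _ | inj₂ h′ =
  ¬HasDUD-D∷Φ-go n y ys sorted noCons (HasDUD-Us++⁻ (y ∸ x) h′)

NoConsecutive⇒¬HasDUD : ∀ n xs → Sorted xs → NoConsecutive xs → ¬ HasDUD (Φ n xs)
NoConsecutive⇒¬HasDUD n []       _      _      = ¬HasDUD-Us n
NoConsecutive⇒¬HasDUD n (x ∷ xs) sorted noCons =
  ¬HasDUD-D∷Φ-go n x xs sorted noCons ∘ HasDUD-Us++⁻ x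

¬HasDUD⇒NoConsecutive : ∀ n c xs → ¬ HasDUD (Φ-go n c xs) → NoConsecutive xs
¬HasDUD⇒NoConsecutive n c []           _ = []
¬HasDUD⇒NoConsecutive n c (x ∷ [])     _ = [-]
¬HasDUD⇒NoConsecutive n c (x ∷ y ∷ ys) ¬dud =
  (λ { refl → ¬dud (Us (x ∸ c) , Φ-go n (suc x) ys ,
         cong (λ k → Us (x ∸ c) ++ D ∷ Us k ++ D ∷ Φ-go n (suc x) ys) (m+n∸n≡m 1 x)) })
  ∷ ¬HasDUD⇒NoConsecutive n x (y ∷ ys) (¬dud ∘ HasDUD-++ˡ (Us (x ∸ c)) ∘ HasDUD-++ˡ (D ∷ []))

Ψ-go : ℕ → Path → List ℕ
Ψ-go c []      = []
Ψ-go c (U ∷ p) = Ψ-go (suc c) p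
Ψ-go c (D ∷ p) = c ∷ Ψ-go c p

Ψ : Path → List ℕ
Ψ = Ψ-go 0

Ψ-go-Us : ∀ c k → Ψ-go c (Us k) ≡ []
Ψ-go-Us c zero    = refl
Ψ-go-Us c (suc k) = Ψ-go-Us (suc c) k

Ψ-go-Us++ : ∀ c k q → Ψ-go c (Us k ++ q) ≡ Ψ-go (k + c) q
Ψ-go-Us++ c zero    q = refl
Ψ-go-Us++ c (suc k) q = trans (Ψ-go-Us++ (suc c) k q) (cong (λ m → Ψ-go m q) (+-suc k c))

Ψ-go-Φ-go : ∀ n c xs → Sorted (c ∷ xs) → Ψ-go c (Φ-go n c xs) ≡ xs
Ψ-go-Φ-go n c []       _              = Ψ-go-Us c (n ∸ c)
Ψ-go-Φ-go n c (x ∷ xs) (c≤x ∷ sorted) = begin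
  Ψ-go c (Us (x ∸ c) ++ D ∷ Φ-go n x xs)     ≡⟨ Ψ-go-Us++ c (x ∸ c) _ ⟩
  Ψ-go (x ∸ c + c) (D ∷ Φ-go n x xs)         ≡⟨ cong (λ m → Ψ-go m (D ∷ Φ-go n x xs)) (m∸n+n≡m c≤x) ⟩
  x ∷ Ψ-go x (Φ-go n x xs)                   ≡⟨ cong (x ∷_) (Ψ-go-Φ-go n x xs sorted) ⟩
  x ∷ xs                                     ∎
  where open ≡-Reasoning

Φ-injective : ∀ n xs ys → Sorted xs → Sorted ys → Φ n xs ≡ Φ n ys → xs ≡ ys
Φ-injective n xs ys sortedˣ sortedʸ eq = begin
  xs                ≡⟨ sym (Ψ-go-Φ-go n 0 xs (Sorted-0∷ sortedˣ)) ⟩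
  Ψ (Φ n xs)        ≡⟨ cong Ψ eq ⟩
  Ψ (Φ n ys)        ≡⟨ Ψ-go-Φ-go n 0 ys (Sorted-0∷ sortedʸ) ⟩
  ys                ∎
  where open ≡-Reasoning

Us-suc : ∀ k q → Us (suc k) ++ q ≡ Us k ++ U ∷ q
Us-suc zero    q = refl
Us-suc (suc k) q = cong (U ∷_) (Us-suc k q)

-- k counts the letters U read since the last D.
Φ-go-Ψ-go : ∀ n c k q → n ≡ k + c + countU q → Φ-go n c (Ψ-go (k + c) q) ≡ Us k ++ q
Φ-go-Ψ-go n c k [] refl
  rewrite +-identityʳ (k + c) | m+n∸n≡m k c = sym (++-identityʳ (Us k))
Φ-go-Ψ-go n c k (U ∷ q) eq =
  trans (Φ-go-Ψ-go n c (suc k) q (trans eq (+-suc (k + c) (countU q)))) (Us-suc k q)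
Φ-go-Ψ-go n c k (D ∷ q) eq
  rewrite m+n∸n≡m k c = cong (λ r → Us k ++ D ∷ r) (Φ-go-Ψ-go n (k + c) 0 q eq)

Φ-Ψ : ∀ p → Φ (countU p) (Ψ p) ≡ p
Φ-Ψ p = Φ-go-Ψ-go (countU p) 0 0 p refl

length-Ψ-go : ∀ c p → length (Ψ-go c p) ≡ countD p
length-Ψ-go c []      = refl
length-Ψ-go c (U ∷ p) = length-Ψ-go (suc c) p
length-Ψ-go c (D ∷ p) = cong suc (length-Ψ-go c p)

Ψ-go-bounded : ∀ c p → All (λ x → c ≤ x × x ≤ c + countU p) (Ψ-go c p)
Ψ-go-bounded c []      = []
Ψ-go-bounded c (U ∷ p) =
  All.map (λ {x} (c<x , x≤) → ≤-trans (n≤1+n c) c<x , subst (x ≤_) (sym (+-suc c (countU p))) x≤)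
          (Ψ-go-bounded (suc c) p)
Ψ-go-bounded c (D ∷ p) = (≤-refl , m≤m+n c _) ∷ Ψ-go-bounded c p

Ψ-go-sorted : ∀ c p → Sorted (c ∷ Ψ-go c p)
Ψ-go-sorted c []      = [-]
Ψ-go-sorted c (U ∷ p) = Sorted-lowerHead (n≤1+n c) (Ψ-go-sorted (suc c) p)
Ψ-go-sorted c (D ∷ p) = ≤-refl ∷ Ψ-go-sorted c p

-- Nonnegativity versus superdiagonality

-- The path entered at height u ∸ d, with u and d kept apart to avoid truncated subtraction.
NonNegativeFrom : ℕ → ℕ → Path → Set
NonNegativeFrom u d p = ∀ k → countD (take k p) + d ≤ countU (take k p) + u

NonNegativeFrom-U∷ : ∀ {u d p} → d ≤ u → NonNegativeFrom (suc u) d p → NonNegativeFrom u d (U ∷ p)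
NonNegativeFrom-U∷                 d≤u _  zero    = d≤u
NonNegativeFrom-U∷ {u} {d} {p} _   nn (suc k) =
  subst (countD (take k p) + d ≤_) (+-suc (countU (take k p)) u) (nn k)

NonNegativeFrom-U∷⁻ : ∀ {u d p} → NonNegativeFrom u d (U ∷ p) → NonNegativeFrom (suc u) d p
NonNegativeFrom-U∷⁻ {u} {d} {p} nn k =
  subst (countD (take k p) + d ≤_) (sym (+-suc (countU (take k p)) u)) (nn (suc k))

NonNegativeFrom-D∷ : ∀ {u d p} → NonNegativeFrom u (suc d) p → NonNegativeFrom u d (D ∷ p)
NonNegativeFrom-D∷             nn zero    = ≤-trans (n≤1+n _) (nn 0)
NonNegativeFrom-D∷ {u} {d} {p} nn (suc k) =
  subst (_≤ countU (take k p) + u) (+-suc (countD (take k p)) d) (nn k)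

NonNegativeFrom-D∷⁻ : ∀ {u d p} → NonNegativeFrom u d (D ∷ p) → NonNegativeFrom u (suc d) p
NonNegativeFrom-D∷⁻ {u} {d} {p} nn k =
  subst (_≤ countU (take k p) + u) (sym (+-suc (countD (take k p)) d)) (nn (suc k))

NonNegativeFrom-Us : ∀ {u d} k → d ≤ u → NonNegativeFrom u d (Us k)
NonNegativeFrom-Us zero    d≤u zero    = d≤u
NonNegativeFrom-Us zero    d≤u (suc _) = d≤u
NonNegativeFrom-Us (suc k) d≤u         =
  NonNegativeFrom-U∷ d≤u (NonNegativeFrom-Us k (≤-trans d≤u (n≤1+n _)))

NonNegativeFrom-Us++ : ∀ {u d} k q → d ≤ u → NonNegativeFrom (k + u) d q →
                       NonNegativeFrom u d (Us k ++ q)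
NonNegativeFrom-Us++         zero    q _   nn = nn
NonNegativeFrom-Us++ {u} {d} (suc k) q d≤u nn =
  NonNegativeFrom-U∷ d≤u
    (NonNegativeFrom-Us++ k q (≤-trans d≤u (n≤1+n u))
      (subst (λ m → NonNegativeFrom m d q) (sym (+-suc k u)) nn))

SuperdiagonalFrom : ℕ → List ℕ → Set
SuperdiagonalFrom d π = (i : Fin (length π)) → suc (d + toℕ i) ≤ lookup π i

SuperdiagonalFrom-head : ∀ {d x xs} → SuperdiagonalFrom d (x ∷ xs) → suc d ≤ x
SuperdiagonalFrom-head {d} {x} sup = subst (λ m → suc m ≤ x) (+-identityʳ d) (sup fzero)

SuperdiagonalFrom-tail : ∀ {d x xs} → SuperdiagonalFrom d (x ∷ xs) → SuperdiagonalFrom (suc d) xs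
SuperdiagonalFrom-tail {d} {x} {xs} sup i =
  subst (_≤ lookup xs i) (cong suc (+-suc d (toℕ i))) (sup (fsuc i))

SuperdiagonalFrom-∷ : ∀ {d x xs} → suc d ≤ x → SuperdiagonalFrom (suc d) xs →
                      SuperdiagonalFrom d (x ∷ xs)
SuperdiagonalFrom-∷ {d} {x}      d<x _   fzero    =
  subst (_≤ x) (cong suc (sym (+-identityʳ d))) d<x
SuperdiagonalFrom-∷ {d} {x} {xs} _   sup (fsuc i) =
  subst (_≤ lookup xs i) (cong suc (sym (+-suc d (toℕ i)))) (sup i)

SuperdiagonalFrom⇒NonNegativeFrom : ∀ n c d xs → d ≤ c → Sorted (c ∷ xs) →
  SuperdiagonalFrom d xs → NonNegativeFrom c d (Φ-go n c xs)
SuperdiagonalFrom⇒NonNegativeFrom n c d []       d≤c _              _   = NonNegativeFrom-Us (n ∸ c) d≤c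
SuperdiagonalFrom⇒NonNegativeFrom n c d (x ∷ xs) d≤c (c≤x ∷ sorted) sup =
  NonNegativeFrom-Us++ (x ∸ c) _ d≤c
    (subst (λ m → NonNegativeFrom m d (D ∷ Φ-go n x xs)) (sym (m∸n+n≡m c≤x))
      (NonNegativeFrom-D∷
        (SuperdiagonalFrom⇒NonNegativeFrom n x (suc d) xs
          (SuperdiagonalFrom-head sup) sorted (SuperdiagonalFrom-tail sup))))

NonNegativeFrom⇒SuperdiagonalFrom : ∀ c d p → NonNegativeFrom c d p → SuperdiagonalFrom d (Ψ-go c p)
NonNegativeFrom⇒SuperdiagonalFrom c d []      _  ()
NonNegativeFrom⇒SuperdiagonalFrom c d (U ∷ p) nn =
  NonNegativeFrom⇒SuperdiagonalFrom (suc c) d p (NonNegativeFrom-U∷⁻ nn)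
NonNegativeFrom⇒SuperdiagonalFrom c d (D ∷ p) nn =
  SuperdiagonalFrom-∷ (nn 1) (NonNegativeFrom⇒SuperdiagonalFrom c (suc d) p (NonNegativeFrom-D∷⁻ nn))

NonNegative⇒NonNegativeFrom : ∀ {p} → NonNegative p → NonNegativeFrom 0 0 p
NonNegative⇒NonNegativeFrom nn k = subst₂ _≤_ (sym (+-identityʳ _)) (sym (+-identityʳ _)) (nn k)

NonNegativeFrom⇒NonNegative : ∀ {p} → NonNegativeFrom 0 0 p → NonNegative p
NonNegativeFrom⇒NonNegative nn k = subst₂ _≤_ (+-identityʳ _) (+-identityʳ _) (nn k)

Φ-startsWithU : ∀ n π → 1 ≤ length π → All (1 ≤_) π → ∃ λ q → Φ n π ≡ U ∷ q
Φ-startsWithU n (suc x ∷ xs) _ (s≤s z≤n ∷ _) = Us x ++ D ∷ Φ-go n (suc x) xs , refl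

Φ-InMstar : ∀ n π → 1 ≤ n → InMstar n π → InGDstar n (Φ n π)
Φ-InMstar n π 1≤n ((refl , bounded , sorted) , noCons) =
  ( countU-Φ-go n 0 π (Sorted-0∷ sorted) (All.map proj₂ bounded)
  , countD-Φ-go n 0 π
  , Φ-startsWithU n π 1≤n (All.map proj₁ bounded) )
  , NoConsecutive⇒¬HasDUD n π sorted noCons

Φ-InMsstar : ∀ n π → 1 ≤ n → InMsstar n π → InDstar n (Φ n π)
Φ-InMsstar n π 1≤n (inM@((_ , _ , sorted) , _) , sup) =
  let (grandDyck , noDUD) = Φ-InMstar n π 1≤n inM
  in (grandDyck , NonNegativeFrom⇒NonNegative
                    (SuperdiagonalFrom⇒NonNegativeFrom n 0 0 π z≤n (Sorted-0∷ sorted) sup))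
     , noDUD

Ψ-InMstar : ∀ n p → InGDstar n p → InMstar n (Ψ p)
Ψ-InMstar .(countU (U ∷ q)) .(U ∷ q) ((refl , #D≡n , q , refl) , noDUD) =
  ( trans (length-Ψ-go 0 (U ∷ q)) #D≡n
  , Ψ-go-bounded 1 q
  , Linked.tail (Ψ-go-sorted 0 (U ∷ q)) )
  , ¬HasDUD⇒NoConsecutive _ 0 (Ψ (U ∷ q)) (noDUD ∘ subst HasDUD (Φ-Ψ (U ∷ q)))

Ψ-InDstar : ∀ n p → InDstar n p → InMsstar n (Ψ p)
Ψ-InDstar n p ((grandDyck , nonNeg) , noDUD) =
  Ψ-InMstar n p (grandDyck , noDUD)
  , NonNegativeFrom⇒SuperdiagonalFrom 0 0 p (NonNegative⇒NonNegativeFrom nonNeg)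

Φ-Ψ-GrandDyck : ∀ n p → IsGrandDyck n p → Φ n (Ψ p) ≡ p
Φ-Ψ-GrandDyck .(countU p) p (refl , _) = Φ-Ψ p

theorem2 : (n : ℕ) → 1 ≤ n →
    RestrictsToBijection (Φ n) (InMstar n) (InGDstar n)
    × RestrictsToBijection (Φ n) (InMsstar n) (InDstar n)
theorem2 n 1≤n =
  ( (λ π → Φ-InMstar n π 1≤n)
  , (λ π σ inπ inσ → Φ-injective n π σ (sorted inπ) (sorted inσ))
  , λ p inp → Ψ p , Ψ-InMstar n p inp , Φ-Ψ-GrandDyck n p (proj₁ inp) )
  , ( (λ π → Φ-InMsstar n π 1≤n)
    , (λ π σ inπ inσ → Φ-injective n π σ (sorted (proj₁ inπ)) (sorted (proj₁ inσ)))
    , λ p inp → Ψ p , Ψ-InDstar n p inp , Φ-Ψ-GrandDyck n p (proj₁ (proj₁ inp)) )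
  where
  sorted : ∀ {π} → InMstar n π → Sorted π
  sorted ((_ , _ , s) , _) = s
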